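{- Let $X\subset\mathbb{R}^d$ with $|X|=n$, let $X=P_1\dot\cup\cdots\dot\cup P_k$ be the partition induced by a label predictor with error rate $\alpha\in[0,\tfrac12)$, and let $c_1,\dots,c_k\in\mathbb{R}^d$ be the centers used to build the flow network $\mathcal{F}$ below. Let an integral optimal flow of $\mathcal{F}$ be given, with cost $F$, and let $Q_i$ be the set of $x\in X$ whose unit of flow from $u_x$ is sent to $v_i$. Then $\frac12\sum_{i\in[k]}\sum_{x_u,x_v\in Q_i}\|x_u-x_v\|_2^2\le F$.
   Context: A label predictor assigns each $x\in X$ a label in $[k]$, inducing $P_i=$ points with label $i$; it has error rate $\alpha$ if there exists an optimal min-sum clustering $P_1^*,\dots,P_k^*$ of $X$ (minimizing $\sum_i\sum_{p,q\in P_i^*}\|p-q\|_2^2$) with $|P_i\cap P_i^*|\ge(1-\alpha)\max(|P_i|,|P_i^*|)$ for all $i$. The flow network $\mathcal{F}$: a source $s$ and sink $t$ with required flow $n$ from $s$ to $t$; a node $u_x$ for each $x\in X$ with an edge $s\to u_x$ of capacity $1$ and cost $0$; a node $v_i$ for each $i\in[k]$ with an edge $v_i\to t$ of capacity $\lfloor|P_i|/(1-\alpha)\rfloor$ and cost $0$, and the constraint that at least $\lceil(1-\alpha)|P_i|\rceil$ flow passes through $v_i$; and for each $x\in X$, $i\in[k]$ an edge $u_x\to v_i$ of capacity $1$ and cost $\frac{1}{1-\alpha}|P_i|\cdot\|x-c_i\|_2^2$. -}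

module Defs where

open import Level using (Level; _⊔_) renaming (suc to lsuc)
open import Algebra.Bundles using (CommutativeRing)
open import Relation.Binary.Core using (Rel)
open import Relation.Binary.Structures using (IsTotalOrder)
open import Relation.Binary.PropositionalEquality using (_≡_)
open import Relation.Nullary using (¬_)
open import Relation.Nullary.Decidable using (⌊_⌋)
open import Data.Bool using (Bool; true; false; _∧_)
open import Data.Nat as ℕ using (ℕ; zero; suc) renaming (_⊔_ to _⊔ℕ_)
open import Data.Fin using (Fin; zero; suc)
import Data.Fin as Fin
open import Data.Product using (Σ; _×_; _,_; ∃)

-- Ordered fields (ℝ is an instance).  The statement is proved for every
-- ordered field; the paper's setting is the instance ℝ.

record OrderedField (c ℓ₁ ℓ₂ : Level) : Set (lsuc (c ⊔ ℓ₁ ⊔ ℓ₂)) where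
  field
    commutativeRing : CommutativeRing c ℓ₁
  open CommutativeRing commutativeRing public
  field
    _≤_          : Rel Carrier ℓ₂
    isTotalOrder : IsTotalOrder _≈_ _≤_
    +-mono-≤     : ∀ {x y} z → x ≤ y → (x + z) ≤ (y + z)
    *-nonneg     : ∀ {x y} → 0# ≤ x → 0# ≤ y → 0# ≤ (x * y)
    0≉1          : ¬ (0# ≈ 1#)
    inv          : Carrier → Carrier
    *-inv        : ∀ x → ¬ (x ≈ 0#) → (x * inv x) ≈ 1#

  _<_ : Rel Carrier (ℓ₁ ⊔ ℓ₂)
  x < y = (x ≤ y) × ¬ (x ≈ y)

count : ∀ {m} → (Fin m → Bool) → ℕ
count {zero}  p = 0
count {suc m} p with p zero
... | true  = suc (count (λ i → p (suc i)))
... | false = count (λ i → p (suc i))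

_=ᵇ_ : ∀ {k} → Fin k → Fin k → Bool
i =ᵇ j = ⌊ i Fin.≟ j ⌋

_=ℕᵇ_ : ℕ → ℕ → Bool
a =ℕᵇ b = ⌊ a ℕ.≟ b ⌋

module _ {c ℓ₁ ℓ₂} (F : OrderedField c ℓ₁ ℓ₂) where
  open OrderedField F
    using (Carrier; _≈_; _≤_; _+_; _*_; _-_; 0#; 1#; inv)

  fromℕ : ℕ → Carrier
  fromℕ zero    = 0#
  fromℕ (suc n) = 1# + fromℕ n

  ind : Bool → Carrier
  ind true  = 1#
  ind false = 0#

  ∑ : ∀ {m} → (Fin m → Carrier) → Carrier
  ∑ {zero}  f = 0#
  ∑ {suc m} f = f zero + ∑ (λ i → f (suc i))

  Point : ℕ → Set c
  Point d = Fin d → Carrier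

  dist² : ∀ {d} → Point d → Point d → Carrier
  dist² x y = ∑ (λ j → (x j - y j) * (x j - y j))

  -- A k-clustering of X = {X 0,…,X (n-1)} is a map σ : Fin n → Fin k
  -- (cluster i is the set of points with σ x ≡ i).

  minSumCost : ∀ {d n k} → (Fin n → Point d) → (Fin n → Fin k) → Carrier
  minSumCost {k = k} X σ =
    ∑ {k} (λ i → ∑ (λ p → ∑ (λ q →
      ind ((σ p =ᵇ i) ∧ (σ q =ᵇ i)) * dist² (X p) (X q))))

  OptimalClustering : ∀ {d n k} → (Fin n → Point d) → (Fin n → Fin k) → Set ℓ₂
  OptimalClustering {k = k} X σ = ∀ (τ : _ → Fin k) → minSumCost X σ ≤ minSumCost X τ

  clusterSize : ∀ {n k} → (Fin n → Fin k) → Fin k → ℕ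
  clusterSize ℓ i = count (λ x → ℓ x =ᵇ i)

  HasErrorRate : ∀ {d n k} → (Fin n → Point d) → (Fin n → Fin k) → Carrier → Set (ℓ₂)
  HasErrorRate {k = k} X ℓ α =
    Σ (_ → Fin k) λ σ → OptimalClustering X σ ×
      (∀ i → ((1# - α) * fromℕ (clusterSize ℓ i ⊔ℕ clusterSize σ i))
               ≤ fromℕ (count (λ x → (ℓ x =ᵇ i) ∧ (σ x =ᵇ i))))

  -- Edges: s→u_x (cap 1, cost 0), u_x→v_i (cap 1,
  -- cost |P_i|/(1−α)·‖x−c_i‖²), v_i→t (cap up i = ⌊|P_i|/(1−α)⌋, cost 0),
  -- at least lo i = ⌈(1−α)|P_i|⌉ units through v_i, required value n.

  record Flow (n k : ℕ) : Set c where
    field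
      fs  : Fin n → Carrier            -- flow on s → u_x
      fuv : Fin n → Fin k → Carrier    -- flow on u_x → v_i
      fvt : Fin k → Carrier            -- flow on v_i → t

  record IntFlow (n k : ℕ) : Set where
    field
      fs  : Fin n → ℕ
      fuv : Fin n → Fin k → ℕ
      fvt : Fin k → ℕ

  toFlow : ∀ {n k} → IntFlow n k → Flow n k
  toFlow g = record { fs  = λ x → fromℕ (IntFlow.fs g x)
                    ; fuv = λ x i → fromℕ (IntFlow.fuv g x i)
                    ; fvt = λ i → fromℕ (IntFlow.fvt g i) }

  Feasible : ∀ {n k} → (up lo : Fin k → ℕ) → Flow n k → Set (ℓ₁ ⊔ ℓ₂)
  Feasible {n} {k} up lo f =
    (∀ x → (0# ≤ fs x) × (fs x ≤ 1#)) ×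
    (∀ x i → (0# ≤ fuv x i) × (fuv x i ≤ 1#)) ×
    (∀ i → (0# ≤ fvt i) × (fvt i ≤ fromℕ (up i))) ×
    (∀ i → fromℕ (lo i) ≤ fvt i) ×
    (∀ x → fs x ≈ ∑ (λ i → fuv x i)) ×
    (∀ i → ∑ (λ x → fuv x i) ≈ fvt i) ×
    (∑ (λ x → fs x) ≈ fromℕ n)
    where open Flow f

  flowCost : ∀ {d n k} → (Fin n → Point d) → (Fin n → Fin k) → Carrier →
             (Fin k → Point d) → Flow n k → Carrier
  flowCost X ℓ α cs f =
    ∑ (λ x → ∑ (λ i → Flow.fuv f x i *
       ((inv (1# - α) * fromℕ (clusterSize ℓ i)) * dist² (X x) (cs i))))

  inQ : ∀ {n k} → IntFlow n k → Fin k → Fin n → Bool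
  inQ g i x = IntFlow.fuv g x i =ℕᵇ 1

  halfQCost : ∀ {d n k} → (Fin n → Point d) → IntFlow n k → Carrier
  halfQCost {k = k} X g =
    inv (1# + 1#) * ∑ {k} (λ i → ∑ (λ x → ∑ (λ y →
      ind (inQ g i x ∧ inQ g i y) * dist² (X x) (X y))))

{-# OPTIONS --safe #-}
-- For any weights w and any centre c, coordinatewise polynomial algebra gives
--   ∑ₓ∑ᵧ wₓwᵧ‖x − y‖² + 2‖∑ₓ wₓ(x − c)‖² = 2 (∑ₓ wₓ) (∑ₓ wₓ‖x − c‖²),
-- so the pairwise cost is at most 2 (∑ w) ∑ₓ wₓ‖x − c‖². In an integral feasible
-- flow every edge u_x → v_i carries 0 or 1 unit, so x ↦ (flow on u_x → v_i) is
-- the indicator of Q_i, and the capacity of v_i → t gives |Q_i| ≤ |P_i|/(1−α).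
-- With c = c_i, half the pairwise cost of Q_i is thus at most
-- ∑_{x ∈ Q_i} |P_i|/(1−α) ‖x − c_i‖², the cost of the flow through v_i.
module Submission where

open import Defs
open import Level using (Level)
open import Data.Nat using (ℕ; zero; suc)
open import Data.Fin using (Fin; zero; suc)
open import Data.Product using (_×_; _,_; proj₁; proj₂)
open import Data.Sum using (inj₁; inj₂)
open import Data.Bool using (true; false; _∧_)
open import Data.Empty using (⊥-elim)
open import Data.Maybe using (nothing)
open import Relation.Binary.PropositionalEquality using (_≡_)
open import Relation.Binary.Bundles using (Poset)
open import Relation.Binary.Structures using (IsTotalOrder)
open import Relation.Nullary using (¬_)

module OrderedFieldProperties {c ℓ₁ ℓ₂} (F : OrderedField c ℓ₁ ℓ₂) where
  open OrderedField F hiding (zero) renaming (+-mono-≤ to +-monoˡ-≤; _≤_ to infix 4 _≤_)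
  open IsTotalOrder isTotalOrder using (total; antisym) renaming (refl to ≤-refl)
  open import Algebra.Properties.Group +-group using (//-rightDividesˡ; //-rightDividesʳ; ⁻¹-involutive)
  open import Algebra.Properties.Ring ring using (-‿distribˡ-*; -‿distribʳ-*)
  open import Algebra.Properties.CommutativeSemigroup +-commutativeSemigroup using (interchange)

  poset : Poset c ℓ₁ ℓ₂
  poset = record { isPartialOrder = IsTotalOrder.isPartialOrder isTotalOrder }

  open import Relation.Binary.Reasoning.PartialOrder poset

  +-mono-≤ : ∀ {x y u v} → x ≤ y → u ≤ v → x + u ≤ y + v
  +-mono-≤ {x} {y} {u} {v} x≤y u≤v = begin
    x + u  ≤⟨ +-monoˡ-≤ u x≤y ⟩
    y + u  ≈⟨ +-comm y u ⟩
    u + y  ≤⟨ +-monoˡ-≤ y u≤v ⟩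
    v + y  ≈⟨ +-comm v y ⟩
    y + v  ∎

  x≤x+y : ∀ {x y} → 0# ≤ y → x ≤ x + y
  x≤x+y {x} {y} 0≤y = begin
    x       ≈⟨ +-identityʳ x ⟨
    x + 0#  ≤⟨ +-mono-≤ ≤-refl 0≤y ⟩
    x + y   ∎

  x≤y⇒0≤y-x : ∀ {x y} → x ≤ y → 0# ≤ y - x
  x≤y⇒0≤y-x {x} {y} x≤y = begin
    0#     ≈⟨ -‿inverseʳ x ⟨
    x - x  ≤⟨ +-monoˡ-≤ (- x) x≤y ⟩
    y - x  ∎

  +-cancelˡ-≤ : ∀ z {x y} → z + x ≤ z + y → x ≤ y
  +-cancelˡ-≤ z {x} {y} z+x≤z+y = begin
    x            ≈⟨ //-rightDividesʳ z x ⟨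
    (x + z) - z  ≈⟨ +-congʳ (+-comm x z) ⟩
    (z + x) - z  ≤⟨ +-monoˡ-≤ (- z) z+x≤z+y ⟩
    (z + y) - z  ≈⟨ +-congʳ (+-comm z y) ⟩
    (y + z) - z  ≈⟨ //-rightDividesʳ z y ⟩
    y            ∎

  *-monoˡ-≤-nonNeg : ∀ {z x y} → 0# ≤ z → x ≤ y → z * x ≤ z * y
  *-monoˡ-≤-nonNeg {z} {x} {y} 0≤z x≤y = begin
    z * x                ≈⟨ +-identityˡ (z * x) ⟨
    0# + z * x           ≤⟨ +-monoˡ-≤ (z * x) (*-nonneg 0≤z (x≤y⇒0≤y-x x≤y)) ⟩
    z * (y - x) + z * x  ≈⟨ distribˡ z (y - x) x ⟨
    z * (y - x + x)      ≈⟨ *-congˡ (//-rightDividesˡ x y) ⟩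
    z * y                ∎

  *-monoʳ-≤-nonNeg : ∀ {z x y} → 0# ≤ z → x ≤ y → x * z ≤ y * z
  *-monoʳ-≤-nonNeg {z} {x} {y} 0≤z x≤y = begin
    x * z  ≈⟨ *-comm x z ⟩
    z * x  ≤⟨ *-monoˡ-≤-nonNeg 0≤z x≤y ⟩
    z * y  ≈⟨ *-comm z y ⟩
    y * z  ∎

  -x*-x≈x*x : ∀ x → - x * - x ≈ x * x
  -x*-x≈x*x x = begin-equality
    - x * - x      ≈⟨ -‿distribˡ-* x (- x) ⟨
    - (x * - x)    ≈⟨ -‿cong (-‿distribʳ-* x x) ⟨
    - (- (x * x))  ≈⟨ ⁻¹-involutive (x * x) ⟩
    x * x          ∎

  x*x-nonNeg : ∀ x → 0# ≤ x * x
  x*x-nonNeg x with total 0# x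
  ... | inj₁ 0≤x = *-nonneg 0≤x 0≤x
  ... | inj₂ x≤0 = begin
    0#         ≤⟨ *-nonneg 0≤-x 0≤-x ⟩
    - x * - x  ≈⟨ -x*-x≈x*x x ⟩
    x * x      ∎
    where
    0≤-x : 0# ≤ - x
    0≤-x = begin
      0#      ≤⟨ x≤y⇒0≤y-x x≤0 ⟩
      0# - x  ≈⟨ +-identityˡ (- x) ⟩
      - x     ∎

  0≤1 : 0# ≤ 1#
  0≤1 = begin
    0#       ≤⟨ x*x-nonNeg 1# ⟩
    1# * 1#  ≈⟨ *-identityˡ 1# ⟩
    1#       ∎

  1≰0 : ¬ (1# ≤ 0#)
  1≰0 1≤0 = 0≉1 (antisym 0≤1 1≤0)

  0≤2 : 0# ≤ 1# + 1#
  0≤2 = begin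
    0#       ≤⟨ 0≤1 ⟩
    1#       ≤⟨ x≤x+y 0≤1 ⟩
    1# + 1#  ∎

  x+x≈2*x : ∀ x → x + x ≈ (1# + 1#) * x
  x+x≈2*x x = begin-equality
    x + x            ≈⟨ +-cong (*-identityˡ x) (*-identityˡ x) ⟨
    1# * x + 1# * x  ≈⟨ distribʳ x 1# 1# ⟨
    (1# + 1#) * x    ∎

  ½ : Carrier
  ½ = inv (1# + 1#)

  2*½≈1 : (1# + 1#) * ½ ≈ 1#
  2*½≈1 = *-inv (1# + 1#) 2≉0
    where
    2≉0 : ¬ (1# + 1# ≈ 0#)
    2≉0 2≈0 = 1≰0 (begin
      1#       ≤⟨ x≤x+y 0≤1 ⟩
      1# + 1#  ≈⟨ 2≈0 ⟩
      0#       ∎)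

  ½*[2*x]≈x : ∀ x → ½ * ((1# + 1#) * x) ≈ x
  ½*[2*x]≈x x = begin-equality
    ½ * ((1# + 1#) * x)  ≈⟨ *-assoc ½ (1# + 1#) x ⟨
    ½ * (1# + 1#) * x    ≈⟨ *-congʳ (trans (*-comm ½ (1# + 1#)) 2*½≈1) ⟩
    1# * x               ≈⟨ *-identityˡ x ⟩
    x                    ∎

  ½-nonNeg : 0# ≤ ½
  ½-nonNeg with total 0# ½
  ... | inj₁ 0≤½ = 0≤½
  ... | inj₂ ½≤0 = ⊥-elim (1≰0 (begin
    1#              ≈⟨ 2*½≈1 ⟨
    (1# + 1#) * ½   ≤⟨ *-monoˡ-≤-nonNeg 0≤2 ½≤0 ⟩
    (1# + 1#) * 0#  ≈⟨ zeroʳ (1# + 1#) ⟩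
    0#              ∎))

  fromℕ-nonNeg : ∀ m → 0# ≤ fromℕ F m
  fromℕ-nonNeg zero    = ≤-refl
  fromℕ-nonNeg (suc m) = begin
    0#              ≤⟨ 0≤1 ⟩
    1#              ≤⟨ x≤x+y (fromℕ-nonNeg m) ⟩
    1# + fromℕ F m  ∎

  fromℕ≤1⇒fromℕ≈ind[≡1] : ∀ m → fromℕ F m ≤ 1# → fromℕ F m ≈ ind F (m =ℕᵇ 1)
  fromℕ≤1⇒fromℕ≈ind[≡1] zero          _    = refl
  fromℕ≤1⇒fromℕ≈ind[≡1] (suc zero)    _    = +-identityʳ 1#
  fromℕ≤1⇒fromℕ≈ind[≡1] (suc (suc m)) 2+m≤1 = ⊥-elim (1≰0 (+-cancelˡ-≤ 1# (begin
    1# + 1#                ≤⟨ +-mono-≤ ≤-refl (x≤x+y (fromℕ-nonNeg m)) ⟩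
    1# + (1# + fromℕ F m)  ≤⟨ 2+m≤1 ⟩
    1#                     ≈⟨ +-identityʳ 1# ⟨
    1# + 0#                ∎)))

  ind-∧ : ∀ a b → ind F (a ∧ b) ≈ ind F a * ind F b
  ind-∧ true  true  = sym (*-identityˡ 1#)
  ind-∧ true  false = sym (zeroʳ 1#)
  ind-∧ false _     = sym (zeroˡ _)

  -- Defs.∑ is extensionally, but not definitionally, equal to the library's
  -- Algebra.Properties.Monoid.Sum.sum, whose laws therefore do not apply to it.
  ∑-cong : ∀ {m} {f g : Fin m → Carrier} → (∀ i → f i ≈ g i) → ∑ F f ≈ ∑ F g
  ∑-cong {zero}  f≈g = refl
  ∑-cong {suc m} f≈g = +-cong (f≈g zero) (∑-cong (λ i → f≈g (suc i)))

  ∑-zero : ∀ m → ∑ F {m} (λ _ → 0#) ≈ 0#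
  ∑-zero zero    = refl
  ∑-zero (suc m) = trans (+-identityˡ _) (∑-zero m)

  ∑-distrib-+ : ∀ {m} (f g : Fin m → Carrier) → ∑ F (λ i → f i + g i) ≈ ∑ F f + ∑ F g
  ∑-distrib-+ {zero}  f g = sym (+-identityˡ 0#)
  ∑-distrib-+ {suc m} f g = trans (+-congˡ (∑-distrib-+ (λ i → f (suc i)) (λ i → g (suc i))))
                                  (interchange (f zero) (g zero) _ _)

  ∑-comm : ∀ {m p} (f : Fin m → Fin p → Carrier) →
           ∑ F (λ i → ∑ F (λ j → f i j)) ≈ ∑ F (λ j → ∑ F (λ i → f i j))
  ∑-comm {zero}  {p} f = sym (∑-zero p)
  ∑-comm {suc m}     f = trans (+-congˡ (∑-comm (λ i → f (suc i))))
                               (sym (∑-distrib-+ (f zero) _))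

  *-distribˡ-∑ : ∀ {m} a (f : Fin m → Carrier) → a * ∑ F f ≈ ∑ F (λ i → a * f i)
  *-distribˡ-∑ {zero}  a f = zeroʳ a
  *-distribˡ-∑ {suc m} a f = trans (distribˡ a _ _) (+-congˡ (*-distribˡ-∑ a (λ i → f (suc i))))

  *-distribʳ-∑ : ∀ {m} a (f : Fin m → Carrier) → ∑ F f * a ≈ ∑ F (λ i → f i * a)
  *-distribʳ-∑ a f = trans (*-comm _ a) (trans (*-distribˡ-∑ a f) (∑-cong (λ i → *-comm a (f i))))

  ∑∑-distrib-+ : ∀ {m p} (f g : Fin m → Fin p → Carrier) →
    ∑ F (λ i → ∑ F (λ j → f i j + g i j)) ≈ ∑ F (λ i → ∑ F (f i)) + ∑ F (λ i → ∑ F (g i))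
  ∑∑-distrib-+ f g = trans (∑-cong (λ i → ∑-distrib-+ (f i) (g i)))
                            (∑-distrib-+ (λ i → ∑ F (f i)) (λ i → ∑ F (g i)))

  ∑∑-product : ∀ {m p} (f : Fin m → Carrier) (g : Fin p → Carrier) →
               ∑ F (λ i → ∑ F (λ j → f i * g j)) ≈ ∑ F f * ∑ F g
  ∑∑-product f g = begin-equality
    ∑ F (λ i → ∑ F (λ j → f i * g j))  ≈⟨ ∑-cong (λ i → *-distribˡ-∑ (f i) g) ⟨
    ∑ F (λ i → f i * ∑ F g)             ≈⟨ *-distribʳ-∑ (∑ F g) f ⟨
    ∑ F f * ∑ F g                       ∎

  ∑-mono-≤ : ∀ {m} {f g : Fin m → Carrier} → (∀ i → f i ≤ g i) → ∑ F f ≤ ∑ F g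
  ∑-mono-≤ {zero}  f≤g = ≤-refl
  ∑-mono-≤ {suc m} f≤g = +-mono-≤ (f≤g zero) (∑-mono-≤ (λ i → f≤g (suc i)))

  ∑-nonNeg : ∀ {m} {f : Fin m → Carrier} → (∀ i → 0# ≤ f i) → 0# ≤ ∑ F f
  ∑-nonNeg {m} {f} 0≤f = begin
    0#                  ≈⟨ ∑-zero m ⟨
    ∑ F {m} (λ _ → 0#)  ≤⟨ ∑-mono-≤ 0≤f ⟩
    ∑ F f               ∎

module PairwiseCost {c ℓ₁ ℓ₂} (F : OrderedField c ℓ₁ ℓ₂) where
  open OrderedField F hiding (zero) renaming (_≤_ to infix 4 _≤_)
  open OrderedFieldProperties F
  open import Relation.Binary.Reasoning.PartialOrder poset
  open import Algebra.Properties.Group +-group using (//-rightDividesˡ)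
  open import Algebra.Properties.CommutativeSemigroup *-commutativeSemigroup using (x∙yz≈y∙xz)
  open import Algebra.Solver.Ring.NaturalCoefficients commutativeSemiring (λ _ _ → nothing)

  p-r≈[p-q]+[q-r] : ∀ p q r → p - r ≈ (p - q) + (q - r)
  p-r≈[p-q]+[q-r] p q r = begin-equality
    p - r                ≈⟨ +-congʳ (//-rightDividesˡ q p) ⟨
    (p - q) + q - r      ≈⟨ +-assoc (p - q) q (- r) ⟩
    (p - q) + (q - r)    ∎

  -- The solver with ℕ coefficients cannot cancel negatives; with u = p − q and
  -- v = q − r, so that p − r = u + v, this becomes a semiring identity in u, v.
  pairwise-identity : ∀ wx wy p q r →
    (wx * wy) * ((p - q) * (p - q)) + ((1# + 1#) * (wx * (p - r))) * (wy * (q - r))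
      ≈ (wx * ((p - r) * (p - r))) * wy + wx * (wy * ((q - r) * (q - r)))
  pairwise-identity wx wy p q r = begin-equality
    (wx * wy) * (u * u) + ((1# + 1#) * (wx * (p - r))) * (wy * v)
      ≈⟨ +-congˡ (*-congʳ (*-congˡ (*-congˡ u+v))) ⟩
    (wx * wy) * (u * u) + ((1# + 1#) * (wx * (u + v))) * (wy * v)
      ≈⟨ semiring-identity wx wy u v ⟩
    (wx * ((u + v) * (u + v))) * wy + wx * (wy * (v * v))
      ≈⟨ +-congʳ (*-congʳ (*-congˡ (*-cong u+v u+v))) ⟨
    (wx * ((p - r) * (p - r))) * wy + wx * (wy * (v * v))
      ∎
    where
    u = p - q
    v = q - r
    u+v : p - r ≈ u + v
    u+v = p-r≈[p-q]+[q-r] p q r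
    semiring-identity : ∀ wx wy u v →
      (wx * wy) * (u * u) + ((1# + 1#) * (wx * (u + v))) * (wy * v)
        ≈ (wx * ((u + v) * (u + v))) * wy + wx * (wy * (v * v))
    semiring-identity = solve 4 (λ wx wy u v →
      (wx :* wy) :* (u :* u) :+ ((con 1 :+ con 1) :* (wx :* (u :+ v))) :* (wy :* v)
        := (wx :* ((u :+ v) :* (u :+ v))) :* wy :+ wx :* (wy :* (v :* v))) refl

  ∑∑-pairwise-sq-≤ : ∀ {n} (w p : Fin n → Carrier) (r : Carrier) →
    ∑ F (λ x → ∑ F (λ y → (w x * w y) * ((p x - p y) * (p x - p y))))
      ≤ (1# + 1#) * (∑ F w * ∑ F (λ x → w x * ((p x - r) * (p x - r))))
  ∑∑-pairwise-sq-≤ w p r = begin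
    A
      ≤⟨ x≤x+y (*-nonneg 0≤2 (x*x-nonNeg T)) ⟩
    A + (1# + 1#) * (T * T)
      ≈⟨ +-congˡ (*-assoc (1# + 1#) T T) ⟨
    A + ((1# + 1#) * T) * T
      ≈⟨ +-congˡ (*-congʳ (*-distribˡ-∑ (1# + 1#) a)) ⟩
    A + ∑ F (λ x → (1# + 1#) * a x) * T
      ≈⟨ +-congˡ (∑∑-product (λ x → (1# + 1#) * a x) a) ⟨
    A + ∑ F (λ x → ∑ F (λ y → ((1# + 1#) * a x) * a y))
      ≈⟨ ∑∑-distrib-+ pair cross ⟨
    ∑ F (λ x → ∑ F (λ y → pair x y + cross x y))
      ≈⟨ ∑-cong (λ x → ∑-cong (λ y → pairwise-identity (w x) (w y) (p x) (p y) r)) ⟩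
    ∑ F (λ x → ∑ F (λ y → m x * w y + w x * m y))
      ≈⟨ ∑∑-distrib-+ (λ x y → m x * w y) (λ x y → w x * m y) ⟩
    ∑ F (λ x → ∑ F (λ y → m x * w y)) + ∑ F (λ x → ∑ F (λ y → w x * m y))
      ≈⟨ +-cong (∑∑-product m w) (∑∑-product w m) ⟩
    M * W + W * M
      ≈⟨ +-congʳ (*-comm M W) ⟩
    W * M + W * M
      ≈⟨ x+x≈2*x (W * M) ⟩
    (1# + 1#) * (W * M)
      ∎
    where
    a m : _ → Carrier
    a x = w x * (p x - r)
    m x = w x * ((p x - r) * (p x - r))
    pair cross : _ → _ → Carrier
    pair x y = (w x * w y) * ((p x - p y) * (p x - p y))
    cross x y = ((1# + 1#) * a x) * a y
    A = ∑ F (λ x → ∑ F (pair x))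
    T = ∑ F a
    W = ∑ F w
    M = ∑ F m

  ∑∑-pairwise-dist²-≤ : ∀ {d n} (X : Fin n → Point F d) (w : Fin n → Carrier) (c : Point F d) →
    ∑ F (λ x → ∑ F (λ y → (w x * w y) * dist² F (X x) (X y)))
      ≤ (1# + 1#) * (∑ F w * ∑ F (λ x → w x * dist² F (X x) c))
  ∑∑-pairwise-dist²-≤ X w c = begin
    ∑ F (λ x → ∑ F (λ y → (w x * w y) * dist² F (X x) (X y)))
      ≈⟨ ∑-cong (λ x → ∑-cong (λ y → *-distribˡ-∑ (w x * w y) (λ j → sq (X x j - X y j)))) ⟩
    ∑ F (λ x → ∑ F (λ y → ∑ F (λ j → (w x * w y) * sq (X x j - X y j))))
      ≈⟨ ∑-cong (λ x → ∑-comm (λ y j → (w x * w y) * sq (X x j - X y j))) ⟩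
    ∑ F (λ x → ∑ F (λ j → ∑ F (λ y → (w x * w y) * sq (X x j - X y j))))
      ≈⟨ ∑-comm (λ x j → ∑ F (λ y → (w x * w y) * sq (X x j - X y j))) ⟩
    ∑ F (λ j → ∑ F (λ x → ∑ F (λ y → (w x * w y) * sq (X x j - X y j))))
      ≤⟨ ∑-mono-≤ (λ j → ∑∑-pairwise-sq-≤ w (λ x → X x j) (c j)) ⟩
    ∑ F (λ j → (1# + 1#) * (W * ∑ F (λ x → w x * sq (X x j - c j))))
      ≈⟨ *-distribˡ-∑ (1# + 1#) (λ j → W * ∑ F (λ x → w x * sq (X x j - c j))) ⟨
    (1# + 1#) * ∑ F (λ j → W * ∑ F (λ x → w x * sq (X x j - c j)))
      ≈⟨ *-congˡ (*-distribˡ-∑ W (λ j → ∑ F (λ x → w x * sq (X x j - c j)))) ⟨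
    (1# + 1#) * (W * ∑ F (λ j → ∑ F (λ x → w x * sq (X x j - c j))))
      ≈⟨ *-congˡ (*-congˡ (∑-comm (λ j x → w x * sq (X x j - c j)))) ⟩
    (1# + 1#) * (W * ∑ F (λ x → ∑ F (λ j → w x * sq (X x j - c j))))
      ≈⟨ *-congˡ (*-congˡ (∑-cong (λ x → *-distribˡ-∑ (w x) (λ j → sq (X x j - c j))))) ⟨
    (1# + 1#) * (W * ∑ F (λ x → w x * dist² F (X x) c))
      ∎
    where
    sq : Carrier → Carrier
    sq t = t * t
    W = ∑ F w

  dist²-nonNeg : ∀ {d} (p q : Point F d) → 0# ≤ dist² F p q
  dist²-nonNeg p q = ∑-nonNeg (λ j → x*x-nonNeg (p j - q j))

  ½∑∑-pairwise-dist²-≤ : ∀ {d n} (X : Fin n → Point F d) (w : Fin n → Carrier) (c : Point F d) K →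
    (∀ x → 0# ≤ w x) → ∑ F w ≤ K →
    ½ * ∑ F (λ x → ∑ F (λ y → (w x * w y) * dist² F (X x) (X y)))
      ≤ ∑ F (λ x → w x * (K * dist² F (X x) c))
  ½∑∑-pairwise-dist²-≤ X w c K 0≤w W≤K = begin
    ½ * ∑ F (λ x → ∑ F (λ y → (w x * w y) * dist² F (X x) (X y)))
      ≤⟨ *-monoˡ-≤-nonNeg ½-nonNeg (∑∑-pairwise-dist²-≤ X w c) ⟩
    ½ * ((1# + 1#) * (∑ F w * Z))
      ≈⟨ ½*[2*x]≈x (∑ F w * Z) ⟩
    ∑ F w * Z
      ≤⟨ *-monoʳ-≤-nonNeg (∑-nonNeg (λ x → *-nonneg (0≤w x) (dist²-nonNeg (X x) c))) W≤K ⟩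
    K * Z
      ≈⟨ *-distribˡ-∑ K (λ x → w x * dist² F (X x) c) ⟩
    ∑ F (λ x → K * (w x * dist² F (X x) c))
      ≈⟨ ∑-cong (λ x → x∙yz≈y∙xz K (w x) (dist² F (X x) c)) ⟩
    ∑ F (λ x → w x * (K * dist² F (X x) c))
      ∎
    where
    Z = ∑ F (λ x → w x * dist² F (X x) c)

  flowTo : ∀ {n k} → IntFlow F n k → Fin k → Fin n → Carrier
  flowTo g i x = fromℕ F (IntFlow.fuv g x i)

  halfQCost≈∑½∑∑flowTo : ∀ {d n k} (X : Fin n → Point F d) (g : IntFlow F n k) →
    (∀ x i → flowTo g i x ≤ 1#) →
    halfQCost F X g
      ≈ ∑ F (λ i → ½ * ∑ F (λ x → ∑ F (λ y → (flowTo g i x * flowTo g i y) * dist² F (X x) (X y))))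
  halfQCost≈∑½∑∑flowTo X g g≤1 = begin-equality
    ½ * ∑ F (λ i → ∑ F (λ x → ∑ F (λ y → ind F (inQ F g i x ∧ inQ F g i y) * dist² F (X x) (X y))))
      ≈⟨ *-distribˡ-∑ ½ (λ i → ∑ F (λ x → ∑ F (λ y →
           ind F (inQ F g i x ∧ inQ F g i y) * dist² F (X x) (X y)))) ⟩
    ∑ F (λ i → ½ * ∑ F (λ x → ∑ F (λ y → ind F (inQ F g i x ∧ inQ F g i y) * dist² F (X x) (X y))))
      ≈⟨ ∑-cong (λ i → *-congˡ (∑-cong (λ x → ∑-cong (λ y → *-congʳ (begin-equality
           ind F (inQ F g i x ∧ inQ F g i y)         ≈⟨ ind-∧ (inQ F g i x) (inQ F g i y) ⟩
           ind F (inQ F g i x) * ind F (inQ F g i y)  ≈⟨ *-cong (indicator x i) (indicator y i) ⟩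
           flowTo g i x * flowTo g i y                ∎))))) ⟩
    ∑ F (λ i → ½ * ∑ F (λ x → ∑ F (λ y → (flowTo g i x * flowTo g i y) * dist² F (X x) (X y))))
      ∎
    where
    indicator : ∀ x i → ind F (inQ F g i x) ≈ flowTo g i x
    indicator x i = sym (fromℕ≤1⇒fromℕ≈ind[≡1] (IntFlow.fuv g x i) (g≤1 x i))

lemma4p5 : ∀ {c ℓ₁ ℓ₂ : Level} (F : OrderedField c ℓ₁ ℓ₂) →
    let open OrderedField F in
    ∀ (d n k : ℕ) (X : Fin n → Point F d) →
    -- X is a set of n distinct points
    (∀ a b → (∀ j → X a j ≈ X b j) → a ≡ b) →
    ∀ (ℓ : Fin n → Fin k) (α : Carrier) →
    0# ≤ α → α < (inv (1# + 1#)) →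
    HasErrorRate F X ℓ α →
    ∀ (cs : Fin k → Point F d) (up lo : Fin k → ℕ) →
    -- up i = ⌊|P_i|/(1−α)⌋
    (∀ i → (fromℕ F (up i) ≤ (fromℕ F (clusterSize F ℓ i) * inv (1# - α)))
         × ((fromℕ F (clusterSize F ℓ i) * inv (1# - α)) < (fromℕ F (up i) + 1#))) →
    -- lo i = ⌈(1−α)|P_i|⌉
    (∀ i → (((1# - α) * fromℕ F (clusterSize F ℓ i)) ≤ fromℕ F (lo i))
         × (fromℕ F (lo i) < (((1# - α) * fromℕ F (clusterSize F ℓ i)) + 1#))) →
    ∀ (g : IntFlow F n k) →
    -- g is an integral optimal flow of 𝓕
    Feasible F up lo (toFlow F g) →
    (∀ (h : Flow F n k) → Feasible F up lo h →
       flowCost F X ℓ α cs (toFlow F g) ≤ flowCost F X ℓ α cs h) →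
    halfQCost F X g ≤ flowCost F X ℓ α cs (toFlow F g)
lemma4p5 F _ _ k X _ ℓ α _ _ _ cs up _ up≤|P|/[1-α] _ g (_ , cap-uv , cap-vt , _ , _ , conserve-v , _) _ =
  begin
    halfQCost F X g
      ≈⟨ halfQCost≈∑½∑∑flowTo X g (λ x i → proj₂ (cap-uv x i)) ⟩
    ∑ F (λ i → ½ * ∑ F (λ x → ∑ F (λ y → (flowTo g i x * flowTo g i y) * dist² F (X x) (X y))))
      ≤⟨ ∑-mono-≤ (λ i → ½∑∑-pairwise-dist²-≤ X (flowTo g i) (cs i) (K i)
                             (λ x → fromℕ-nonNeg (IntFlow.fuv g x i)) (|Q|≤K i)) ⟩
    ∑ F (λ i → ∑ F (λ x → flowTo g i x * (K i * dist² F (X x) (cs i))))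
      ≈⟨ ∑-comm (λ i x → flowTo g i x * (K i * dist² F (X x) (cs i))) ⟩
    flowCost F X ℓ α cs (toFlow F g)
      ∎
  where
  open OrderedField F hiding (zero) renaming (_≤_ to infix 4 _≤_)
  open OrderedFieldProperties F
  open PairwiseCost F
  open import Relation.Binary.Reasoning.PartialOrder poset

  K : Fin k → Carrier
  K i = inv (1# - α) * fromℕ F (clusterSize F ℓ i)

  |Q|≤K : ∀ i → ∑ F (flowTo g i) ≤ K i
  |Q|≤K i = begin
    ∑ F (flowTo g i)                              ≈⟨ conserve-v i ⟩
    fromℕ F (IntFlow.fvt g i)                     ≤⟨ proj₂ (cap-vt i) ⟩
    fromℕ F (up i)                                ≤⟨ proj₁ (up≤|P|/[1-α] i) ⟩
    fromℕ F (clusterSize F ℓ i) * inv (1# - α)  ≈⟨ *-comm _ _ ⟩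
    K i                                           ∎
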